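{- Let $k\geq 2$ and let $n$ be odd. If $q_k(n-1)$ exists, then $q_k(n)$ exists and $q_k(n)\leq q_k(n-1)$.
   Context: There are $n$ balls with distinct identities, each colored with one of two colors; the coloring is unknown to a questioner. A color is the majority color if strictly more than half of the balls have it. The majority problem is: determine with certainty whether a majority color exists, and if it does, output a ball of the majority color. The questioner may adaptively ask $k$-queries in the Y/N model: choose a set of $k$ distinct balls and receive the answer YES if all $k$ balls have the same color and NO otherwise (answers are consistent with the hidden coloring and may be adversarial). $q_k(n)$ denotes the minimum number of such queries that suffice in the worst case to solve the majority problem for $n$ balls (it exists if some finite number suffices). -}

module Defs where

open import Data.Nat using (ℕ; zero; suc; _+_; _*_; _<_; _≤_; _⊔_)
open import Data.Bool using (Bool; true; false; not; _∧_; _∨_; if_then_else_; _≟_)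
open import Data.Fin using (Fin; zero; suc)
open import Data.Maybe using (Maybe; just; nothing)
open import Data.Product using (Σ; _×_; _,_)
open import Function using (_∘_)
open import Function.Definitions using (Injective)
open import Relation.Binary.PropositionalEquality using (_≡_)
open import Relation.Nullary using (¬_)
open import Relation.Nullary.Decidable using (isYes)

Coloring : ℕ → Set
Coloring n = Fin n → Bool

-- A k-query: a choice of k DISTINCT balls, i.e. an injective map Fin k → Fin n.
Query : ℕ → ℕ → Set
Query k n = Σ (Fin k → Fin n) (Injective _≡_ _≡_)

allTrue : ∀ {k} → (Fin k → Bool) → Bool
allTrue {zero} f = true
allTrue {suc k} f = f zero ∧ allTrue (f ∘ suc)

answer : ∀ {k n} → Coloring n → Query k n → Bool
answer c (f , _) = allTrue (c ∘ f) ∨ allTrue (not ∘ c ∘ f)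

-- Output: nothing = "there is no majority color", just i = "ball i has the majority color".
Output : ℕ → Set
Output n = Maybe (Fin n)

-- Adaptive strategy = decision tree of k-queries.
data Tree (k n : ℕ) : Set where
  leaf : Output n → Tree k n
  node : Query k n → (onYes onNo : Tree k n) → Tree k n

-- Worst-case number of queries = depth of the tree.
depth : ∀ {k n} → Tree k n → ℕ
depth (leaf _) = 0
depth (node _ y m) = suc (depth y ⊔ depth m)

run : ∀ {k n} → Tree k n → Coloring n → Output n
run (leaf o) c = o
run (node q y m) c = if answer c q then run y c else run m c

count : ∀ {n} → Coloring n → Bool → ℕ
count {zero} c b = 0
count {suc n} c b = (if isYes (c zero ≟ b) then 1 else 0) + count (c ∘ suc) b

Majority : ∀ {n} → Coloring n → Bool → Set
Majority {n} c b = n < 2 * count c b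

Correct : ∀ {n} → Coloring n → Output n → Set
Correct c nothing = ∀ b → ¬ Majority c b
Correct c (just i) = Majority c (c i)

-- The majority problem for n balls can be solved with at most q k-queries
-- in the worst case (over all colorings, i.e. adversarial consistent answers).
Solvable : ℕ → ℕ → ℕ → Set
Solvable k n q = Σ (Tree k n) λ t → depth t ≤ q × (∀ (c : Coloring n) → Correct c (run t c))

-- Run an optimal strategy for n − 1 of the balls (an even number), ignoring
-- one extra ball (here ball 0). A strict majority among an even number of balls
-- exceeds half by at least one, so it stays a majority whatever the extra
-- ball's color. If there is no majority among an even number of balls, the
-- two colors are tied, and the extra ball's color becomes the majority.
module Submission where

open import Defs
open import Data.Nat using (ℕ; _≤_; _∸_; _%_)
open import Relation.Binary.PropositionalEquality using (_≡_)

open import Data.Nat using (zero; suc; _+_; _*_; _<_; _⊔_; _/_)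
open import Data.Nat.Properties
  using (+-commutativeSemigroup; +-identityʳ; +-monoʳ-≤; +-cancelʳ-≤; *-suc; *-comm; *-distribˡ-+;
         *-monoʳ-≤; *-cancelˡ-<; m≤n+m; ≮⇒≥; n<1+n; ≤-trans; ≤-antisym)
open import Algebra.Properties.CommutativeSemigroup +-commutativeSemigroup using (interchange)
open import Data.Nat.DivMod using (m≡m%n+[m/n]*n)
open import Data.Bool using (Bool; true; false; not; if_then_else_; _≟_)
open import Data.Fin using (zero; suc)
import Data.Fin.Properties as Fin
open import Data.Maybe using (just; nothing)
open import Data.Product using (_,_)
open import Function using (_∘_)
open import Relation.Binary.PropositionalEquality using (refl; sym; cong; cong₂; subst; module ≡-Reasoning)
open import Relation.Nullary using (¬_)
open import Relation.Nullary.Decidable using (isYes)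

δ : Bool → Bool → ℕ
δ x b = if isYes (x ≟ b) then 1 else 0

δ-refl : ∀ x → δ x x ≡ 1
δ-refl false = refl
δ-refl true  = refl

δ-complement : ∀ x b → δ x b + δ x (not b) ≡ 1
δ-complement false false = refl
δ-complement false true  = refl
δ-complement true  false = refl
δ-complement true  true  = refl

count-complement : ∀ {n} (c : Coloring n) b → count c b + count c (not b) ≡ n
count-complement {zero}  c b = refl
count-complement {suc n} c b = begin
  (δ x b + count (c ∘ suc) b) + (δ x (not b) + count (c ∘ suc) (not b))
    ≡⟨ interchange (δ x b) _ (δ x (not b)) _ ⟩
  (δ x b + δ x (not b)) + (count (c ∘ suc) b + count (c ∘ suc) (not b))
    ≡⟨ cong₂ _+_ (δ-complement x b) (count-complement (c ∘ suc) b) ⟩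
  suc n ∎
  where
  open ≡-Reasoning
  x = c zero

no-majority⇒tie : ∀ {n} (c : Coloring n) → (∀ b → ¬ Majority c b) → ∀ b → 2 * count c b ≡ n
no-majority⇒tie {n} c no-majority b = ≤-antisym (at-most-half b) at-least-half
  where
  at-most-half : ∀ b → 2 * count c b ≤ n
  at-most-half b = ≮⇒≥ (no-majority b)

  doubles-sum : 2 * count c b + 2 * count c (not b) ≡ n + n
  doubles-sum = begin
    2 * count c b + 2 * count c (not b) ≡⟨ sym (*-distribˡ-+ 2 (count c b) _) ⟩
    2 * (count c b + count c (not b))   ≡⟨ cong (2 *_) (count-complement c b) ⟩
    n + (n + 0)                         ≡⟨ cong (n +_) (+-identityʳ n) ⟩
    n + n                               ∎
    where open ≡-Reasoning

  at-least-half : n ≤ 2 * count c b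
  at-least-half = +-cancelʳ-≤ n n (2 * count c b)
    (subst (_≤ 2 * count c b + n) doubles-sum (+-monoʳ-≤ (2 * count c b) (at-most-half (not b))))

double-<⇒suc-double-< : ∀ h a → 2 * h < 2 * a → suc (2 * h) < 2 * a
double-<⇒suc-double-< h a 2h<2a =
  subst (_≤ 2 * a) (*-suc 2 h) (*-monoʳ-≤ 2 (*-cancelˡ-< 2 h a 2h<2a))

majority-extend : ∀ h (c : Coloring (suc (2 * h))) b → Majority (c ∘ suc) b → Majority c b
majority-extend h c b maj = ≤-trans
  (double-<⇒suc-double-< h (count (c ∘ suc) b) maj)
  (*-monoʳ-≤ 2 (m≤n+m (count (c ∘ suc) b) (δ (c zero) b)))

tie⇒majority-first : ∀ {n} (c : Coloring (suc n)) → (∀ b → ¬ Majority (c ∘ suc) b) →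
  Majority c (c zero)
tie⇒majority-first {n} c no-majority
  rewrite δ-refl (c zero) | *-suc 2 (count (c ∘ suc) (c zero))
        | no-majority⇒tie (c ∘ suc) no-majority (c zero) = n<1+n (suc n)

extendOutput : ∀ {n} → Output n → Output (suc n)
extendOutput nothing  = just zero
extendOutput (just i) = just (suc i)

module _ {k n : ℕ} where

  extendQuery : Query k n → Query k (suc n)
  extendQuery (f , f-injective) = suc ∘ f , f-injective ∘ Fin.suc-injective

  extendTree : Tree k n → Tree k (suc n)
  extendTree (leaf o)     = leaf (extendOutput o)
  extendTree (node q y m) = node (extendQuery q) (extendTree y) (extendTree m)

  depth-extendTree : ∀ t → depth (extendTree t) ≡ depth t
  depth-extendTree (leaf o) = refl
  depth-extendTree (node q y m) = cong suc (cong₂ _⊔_ (depth-extendTree y) (depth-extendTree m))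

  run-extendTree : ∀ t (c : Coloring (suc n)) → run (extendTree t) c ≡ extendOutput (run t (c ∘ suc))
  run-extendTree (leaf o) c = refl
  run-extendTree (node q y m) c with answer (c ∘ suc) q
  ... | true  = run-extendTree y c
  ... | false = run-extendTree m c

correct-extendOutput : ∀ h (c : Coloring (suc (2 * h))) o →
  Correct (c ∘ suc) o → Correct c (extendOutput o)
correct-extendOutput h c nothing  no-majority = tie⇒majority-first c no-majority
correct-extendOutput h c (just i) maj         = majority-extend h c (c (suc i)) maj

solvable-suc-double : ∀ k h q → Solvable k (2 * h) q → Solvable k (suc (2 * h)) q
solvable-suc-double k h q (t , depth≤q , correct) =
  extendTree t ,
  subst (_≤ q) (sym (depth-extendTree t)) depth≤q ,
  λ c → subst (Correct c) (sym (run-extendTree t c))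
              (correct-extendOutput h c (run t (c ∘ suc)) (correct (c ∘ suc)))

odd⇒suc-double : ∀ n → n % 2 ≡ 1 → n ≡ suc (2 * (n / 2))
odd⇒suc-double n n-odd = begin
  n                   ≡⟨ m≡m%n+[m/n]*n n 2 ⟩
  n % 2 + n / 2 * 2   ≡⟨ cong₂ _+_ n-odd (*-comm (n / 2) 2) ⟩
  suc (2 * (n / 2))   ∎
  where open ≡-Reasoning

lemma3p1 : (k n : ℕ) → 2 ≤ k → n % 2 ≡ 1 →
    ∀ (q : ℕ) → Solvable k (n ∸ 1) q → Solvable k n q
lemma3p1 k n _ n-odd q =
  subst (λ m → Solvable k (m ∸ 1) q → Solvable k m q) (sym (odd⇒suc-double n n-odd))
        (solvable-suc-double k (n / 2) q)
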